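{- Up to isomorphism, there is a unique 2-cell embedding of $K_{3,3}$ on the double torus.
   Context: The double torus is the orientable surface of genus 2. A 2-cell embedding (every face homeomorphic to an open disc) of a graph $G$ on an orientable surface is described by a rotation system: for each vertex a cyclic ordering of its incident edges. Two embeddings are isomorphic if some permutation of the vertices and edges of $G$ (preserving incidence) transforms one rotation system into the other. -}

module Defs where

open import Data.Bool using (Bool; true; false; not; if_then_else_)
open import Data.Fin using (Fin; toℕ)
open import Data.Nat using (ℕ; zero; suc; _+_; _*_; _≤ᵇ_)
open import Data.Product using (_×_; _,_; proj₁; proj₂; ∃)
open import Data.List using (List; length; filterᵇ; upTo; allFin; cartesianProduct; map)
open import Data.Bool.ListAction using (all)
open import Function using (_∘_; _↔_; Inverse)
open import Function.Definitions using (Injective)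
open import Relation.Binary.PropositionalEquality using (_≡_)

iter : {A : Set} → (A → A) → ℕ → A → A
iter f zero    x = x
iter f (suc n) x = f (iter f n x)

-- Vertices: (side , index) with side : Bool (the two colour classes)
-- and index : Fin 3.  Two vertices are adjacent iff they lie on
-- different sides.  K_{3,3} is simple, so an edge is determined by its
-- endpoints; the edge {(s,i),(not s,j)} is identified with the two darts
-- (s , i , j) and (not s , j , i).

Vertex : Set
Vertex = Bool × Fin 3

Adjacent : Vertex → Vertex → Set
Adjacent (s , _) (t , _) = not s ≡ t

Dart : Set
Dart = Bool × Fin 3 × Fin 3

tail : Dart → Vertex
tail (s , i , _) = s , i

head : Dart → Vertex
head (s , _ , j) = not s , j

-- At vertex v the neighbours are indexed by Fin 3 (neighbour j of (s,i)
-- is (not s , j)); a rotation at v is a cyclic ordering of the incident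
-- edges, i.e. a cyclic permutation (a single 3-cycle) of Fin 3.

IsCyclicPermutation : (Fin 3 → Fin 3) → Set
IsCyclicPermutation f = Injective _≡_ _≡_ f × (∀ j k → ∃ λ n → iter f n j ≡ k)

Rotation : Set
Rotation = Vertex → Fin 3 → Fin 3

IsRotationSystem : Rotation → Set
IsRotationSystem ρ = ∀ v → IsCyclicPermutation (ρ v)

-- Face-tracing permutation: after traversing the dart u → w, continue
-- with the dart leaving w that follows (the reverse of) u → w in the
-- rotation at w.
face-step : Rotation → Dart → Dart
face-step ρ (s , i , j) = not s , j , ρ (not s , j) i

-- Encoding of darts as numbers 0..17 (to pick orbit representatives).
dartCode : Dart → ℕ
dartCode (s , i , j) = (if s then 9 else 0) + (3 * toℕ i + toℕ j)

allDarts : List Dart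
allDarts = cartesianProduct (true ∷′ false ∷′ []′) (cartesianProduct (allFin 3) (allFin 3))
  where
  open Data.List using () renaming (_∷_ to _∷′_; [] to []′)

-- A dart represents its face (orbit of face-step) if it has the least
-- code in its orbit; orbits have length ≤ 18.
isFaceRep : Rotation → Dart → Bool
isFaceRep ρ d = all (λ n → dartCode d ≤ᵇ dartCode (iter (face-step ρ) n d)) (upTo 18)

faces : Rotation → ℕ
faces ρ = length (filterᵇ (isFaceRep ρ) allDarts)

-- The 2-cell embedding given by ρ lies on the orientable surface of
-- genus g, by Euler's formula V − E + F = 2 − 2g with V = 6, E = 9.
EmbedsOnGenus : Rotation → ℕ → Set
EmbedsOnGenus ρ g = 6 + faces ρ + 2 * g ≡ 9 + 2

-- Isomorphism of embeddings: a graph automorphism α of K_{3,3}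
-- (a vertex bijection preserving and reflecting adjacency; it induces
-- the edge permutation) carrying one rotation system to the other.

IsAutomorphism : (Vertex ↔ Vertex) → Set
IsAutomorphism α = ∀ u w → (Adjacent u w → Adjacent (f u) (f w)) × (Adjacent (f u) (f w) → Adjacent u w)
  where f = Inverse.to α

mapDart : (Vertex ↔ Vertex) → Dart → Dart
mapDart α d = proj₁ (f (tail d)) , proj₂ (f (tail d)) , proj₂ (f (head d))
  where f = Inverse.to α

rotDart : Rotation → Dart → Dart
rotDart ρ (s , i , j) = s , i , ρ (s , i) j

IsomorphicEmbeddings : Rotation → Rotation → Set
IsomorphicEmbeddings ρ ρ′ = ∃ λ (α : Vertex ↔ Vertex) →
  IsAutomorphism α × (∀ d → rotDart ρ′ (mapDart α d) ≡ mapDart α (rotDart ρ d))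

-- A rotation at a vertex of degree 3 is one of the two cyclic orders of its three edges,
-- so a rotation system of K_{3,3} is a choice of six bits. By Euler's formula
-- 6 − 9 + F = 2 − 2g, genus 2 means exactly one face. Running through all 64 choices,
-- each one-face system is carried onto ρ₀ by one of the 72 automorphisms of K_{3,3}
-- (an optional swap of the two sides followed by a permutation of each side).

module Submission where

open import Defs
open import Data.Bool using (Bool; true; false; not; _xor_; T; T?)
open import Data.Bool.ListAction using (and)
open import Data.Bool.Properties using (xor-assoc; xor-same) renaming (_≟_ to _≟ᵇ_)
open import Data.Fin using (Fin; suc; toℕ)
open import Data.Fin.Patterns using (0F; 1F; 2F)
open import Data.Fin.Permutation using (Permutation′; _⟨$⟩ʳ_; _⟨$⟩ˡ_; inverseˡ; inverseʳ; transpose; _∘ₚ_) renaming (id to idₚ)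
open import Data.Fin.Properties using (all?; any?) renaming (_≟_ to _≟ᶠ_)
open import Data.List using (List; []; _∷_; cartesianProduct; length; upTo)
open import Data.List.Properties using (filter-≐; map-cong)
open import Data.List.Relation.Unary.Any using (Any; satisfied) renaming (any? to anyᴸ?)
open import Data.Nat using (zero; suc; _+_; _*_; _≤ᵇ_) renaming (_≟_ to _≟ⁿ_)
open import Data.Product using (_×_; ∃; _,_; proj₁; proj₂)
open import Data.Product.Properties using (≡-dec)
open import Data.Sum using (_⊎_; [_,_]′) renaming (map to map⊎)
open import Data.Vec using (Vec; []; _∷_; lookup; tabulate)
open import Data.Vec.Properties using (lookup∘tabulate)
open import Function using (id; _∘_; _↔_; mk↔ₛ′)
open import Function.Definitions using (Injective)
open import Relation.Binary.PropositionalEquality using (_≡_; _≢_; _≗_; refl; sym; trans; cong; cong₂; subst)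
open import Relation.Nullary using (Dec; yes; no; map′; ¬?; _→-dec_; _⊎-dec_)
open import Relation.Nullary.Decidable using (from-yes)
open import Relation.Unary using (Decidable)

allBool? : {P : Bool → Set} → Decidable P → Dec (∀ b → P b)
allBool? P? with P? true | P? false
... | yes pt | yes pf = yes λ { true → pt ; false → pf }
... | no ¬pt | _      = no λ all → ¬pt (all true)
... | _      | no ¬pf = no λ all → ¬pf (all false)

allBoolVec? : ∀ {n} {P : Vec Bool n → Set} → Decidable P → Dec (∀ v → P v)
allBoolVec? {zero}  P? = map′ (λ { p [] → p }) (λ all → all []) (P? [])
allBoolVec? {suc n} P? = map′ (λ { all (b ∷ v) → all b v }) (λ all b v → all (b ∷ v))
  (allBool? λ b → allBoolVec? (P? ∘ (b ∷_)))

allDart? : {P : Dart → Set} → Decidable P → Dec (∀ d → P d)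
allDart? P? = map′ (λ all (s , i , j) → all s i j) (λ all s i j → all (s , i , j))
  (allBool? λ s → all? λ i → all? λ j → P? (s , i , j))

_≟ᵈ_ : (d d′ : Dart) → Dec (d ≡ d′)
_≟ᵈ_ = ≡-dec _≟ᵇ_ (≡-dec _≟ᶠ_ _≟ᶠ_)

iter-fixed : {A : Set} {f : A → A} {x : A} → f x ≡ x → ∀ n → iter f n x ≡ x
iter-fixed         fx≡x zero    = refl
iter-fixed {f = f} fx≡x (suc n) = trans (cong f (iter-fixed fx≡x n)) fx≡x

iter-cong : {A : Set} {f g : A → A} → f ≗ g → ∀ n → iter f n ≗ iter g n
iter-cong         f≗g zero    x = refl
iter-cong {f = f} f≗g (suc n) x = trans (cong f (iter-cong f≗g n x)) (f≗g _)

FixedPointFree : {A : Set} → (A → A) → Set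
FixedPointFree f = ∀ x → f x ≢ x

cycle : Bool → Fin 3 → Fin 3
cycle true  0F = 1F
cycle true  1F = 2F
cycle true  2F = 0F
cycle false 0F = 2F
cycle false 1F = 0F
cycle false 2F = 1F

cycle-isCyclicPermutation : ∀ s → IsCyclicPermutation (cycle s)
cycle-isCyclicPermutation s = (λ {x y} → from-yes injective? s x y) , λ j k →
  let n , reached = from-yes orbit? s j k in toℕ n , reached
  where
  injective? : Dec (∀ s x y → cycle s x ≡ cycle s y → x ≡ y)
  injective? = allBool? λ s → all? λ x → all? λ y → cycle s x ≟ᶠ cycle s y →-dec x ≟ᶠ y
  orbit? : Dec (∀ s j k → ∃ λ (n : Fin 3) → iter (cycle s) (toℕ n) j ≡ k)
  orbit? = allBool? λ s → all? λ j → all? λ k → any? λ n → iter (cycle s) (toℕ n) j ≟ᶠ k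

cyclic⇒fixedPointFree : ∀ {f} → IsCyclicPermutation f → FixedPointFree f
cyclic⇒fixedPointFree (_ , orbit) 0F fixed
  with n , reached ← orbit 0F 1F
  with () ← trans (sym (iter-fixed fixed n)) reached
cyclic⇒fixedPointFree (_ , orbit) (suc j) fixed
  with n , reached ← orbit (suc j) 0F
  with () ← trans (sym (iter-fixed fixed n)) reached

derangement⇒cycle? : Dec (∀ a b c → let f = lookup (a ∷ b ∷ c ∷ []) in
  (∀ x y → f x ≡ f y → x ≡ y) → FixedPointFree f → f ≗ cycle true ⊎ f ≗ cycle false)
derangement⇒cycle? = all? λ a → all? λ b → all? λ c → let f = lookup (a ∷ b ∷ c ∷ []) in
  (all? λ x → all? λ y → f x ≟ᶠ f y →-dec x ≟ᶠ y) →-dec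
  (all? λ x → ¬? (f x ≟ᶠ x)) →-dec
  ((all? λ x → f x ≟ᶠ cycle true x) ⊎-dec (all? λ x → f x ≟ᶠ cycle false x))

-- Opaque because unfolding the exhaustive check at an unknown f makes type checking blow up.
opaque
  derangement⇒cycle : ∀ {f} → Injective _≡_ _≡_ f → FixedPointFree f → f ≗ cycle true ⊎ f ≗ cycle false
  derangement⇒cycle {f} injective fixedPointFree =
    map⊎ (from-table ∘_) (from-table ∘_) (from-yes derangement⇒cycle? (f 0F) (f 1F) (f 2F)
      (λ x y fx≡fy → injective (trans (to-table x) (trans fx≡fy (sym (to-table y)))))
      (λ x fx≡x → fixedPointFree x (trans (to-table x) fx≡x)))
    where
    to-table : ∀ x → f x ≡ lookup (tabulate f) x
    to-table x = sym (lookup∘tabulate f x)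
    from-table : ∀ {x y} → lookup (tabulate f) x ≡ y → f x ≡ y
    from-table = trans (to-table _)

cyclic⇒cycle : ∀ {f} → IsCyclicPermutation f → ∃ λ s → f ≗ cycle s
cyclic⇒cycle c@(injective , _) = [ (true ,_) , (false ,_) ]′ (derangement⇒cycle injective (cyclic⇒fixedPointFree c))

_≋_ : Rotation → Rotation → Set
ρ ≋ σ = ∀ v → ρ v ≗ σ v

faces-cong : ∀ {ρ σ} → ρ ≋ σ → faces ρ ≡ faces σ
faces-cong {ρ} {σ} ρ≋σ = cong length (filter-≐ (T? ∘ isFaceRep ρ) (T? ∘ isFaceRep σ)
  ((λ {d} → subst T (isFaceRep-cong d)) , (λ {d} → subst T (sym (isFaceRep-cong d)))) allDarts)
  where
  face-step-cong : face-step ρ ≗ face-step σ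
  face-step-cong (s , i , j) = cong (λ k → not s , j , k) (ρ≋σ _ i)
  isFaceRep-cong : isFaceRep ρ ≗ isFaceRep σ
  isFaceRep-cong d = cong and (map-cong (λ n → cong (λ d′ → dartCode d ≤ᵇ dartCode d′) (iter-cong face-step-cong n d)) (upTo 18))

embedsOnGenus-cong : ∀ {ρ σ g} → ρ ≋ σ → EmbedsOnGenus ρ g → EmbedsOnGenus σ g
embedsOnGenus-cong {g = g} ρ≋σ = subst (λ F → 6 + F + 2 * g ≡ 9 + 2) (faces-cong ρ≋σ)

isomorphicEmbeddings-congˡ : ∀ {ρ σ τ} → ρ ≋ σ → IsomorphicEmbeddings σ τ → IsomorphicEmbeddings ρ τ
isomorphicEmbeddings-congˡ ρ≋σ (α , automorphism , commutes) = α , automorphism , λ d@(s , i , j) →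
  trans (commutes d) (cong (λ k → mapDart α (s , i , k)) (sym (ρ≋σ (s , i) j)))

Orientation : Set
Orientation = Vec Bool 3 × Vec Bool 3

sense : Orientation → Vertex → Bool
sense (os , _)  (true  , i) = lookup os i
sense (_  , os) (false , i) = lookup os i

rotationOf : Orientation → Rotation
rotationOf o v = cycle (sense o v)

rotationOf-isRotationSystem : ∀ o → IsRotationSystem (rotationOf o)
rotationOf-isRotationSystem o v = cycle-isCyclicPermutation (sense o v)

orientationOf : (ρ : Rotation) → IsRotationSystem ρ → Orientation
orientationOf ρ R = tabulate (senseAt true) , tabulate (senseAt false)
  where
  senseAt : Bool → Fin 3 → Bool
  senseAt s i = proj₁ (cyclic⇒cycle (R (s , i)))

sense-orientationOf : ∀ ρ R v → sense (orientationOf ρ R) v ≡ proj₁ (cyclic⇒cycle (R v))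
sense-orientationOf ρ R (true  , i) = lookup∘tabulate (λ i → proj₁ (cyclic⇒cycle (R (true  , i)))) i
sense-orientationOf ρ R (false , i) = lookup∘tabulate (λ i → proj₁ (cyclic⇒cycle (R (false , i)))) i

rotationOf-orientationOf : ∀ ρ R → ρ ≋ rotationOf (orientationOf ρ R)
rotationOf-orientationOf ρ R v j =
  trans (proj₂ (cyclic⇒cycle (R v)) j) (cong (λ s → cycle s j) (sym (sense-orientationOf ρ R v)))

Symmetry : Set
Symmetry = Bool × Permutation′ 3 × Permutation′ 3

symmetry : Symmetry → Vertex ↔ Vertex
symmetry (b , π , π′) = mk↔ₛ′ to from to∘from from∘to
  where
  perm : Bool → Permutation′ 3
  perm true  = π
  perm false = π′
  to from : Vertex → Vertex
  to   (s , i) = b xor s , perm s ⟨$⟩ʳ i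
  from (t , k) = b xor t , perm (b xor t) ⟨$⟩ˡ k
  xor-cancel : ∀ s → b xor (b xor s) ≡ s
  xor-cancel s = trans (sym (xor-assoc b b s)) (cong (_xor s) (xor-same b))
  to∘from : ∀ v → to (from v) ≡ v
  to∘from (t , k) = cong₂ _,_ (xor-cancel t) (inverseʳ (perm (b xor t)))
  from∘to : ∀ v → from (to v) ≡ v
  from∘to (s , i) rewrite xor-cancel s = cong (s ,_) (inverseˡ (perm s))

symmetry-isAutomorphism : ∀ σ → IsAutomorphism (symmetry σ)
symmetry-isAutomorphism (b , _) (s , _) (t , _) = preserves b s t , reflects b s t
  where
  preserves : ∀ b s t → not s ≡ t → not (b xor s) ≡ b xor t
  preserves false s t = id
  preserves true  s t = cong not
  reflects : ∀ b s t → not (b xor s) ≡ b xor t → not s ≡ t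
  reflects false s     t     = id
  reflects true  true  false _ = refl
  reflects true  false true  _ = refl
  reflects true  true  true  ()
  reflects true  false false ()

permutations₃ : List (Permutation′ 3)
permutations₃ = idₚ ∷ transpose 0F 1F ∷ transpose 0F 2F ∷ transpose 1F 2F
  ∷ transpose 0F 1F ∘ₚ transpose 1F 2F ∷ transpose 1F 2F ∘ₚ transpose 0F 1F ∷ []

symmetries : List Symmetry
symmetries = cartesianProduct (true ∷ false ∷ []) (cartesianProduct permutations₃ permutations₃)

Carries : Symmetry → Rotation → Rotation → Set
Carries σ ρ ρ′ = ∀ d → rotDart ρ′ (mapDart (symmetry σ) d) ≡ mapDart (symmetry σ) (rotDart ρ d)

carries? : ∀ σ ρ ρ′ → Dec (Carries σ ρ ρ′)
carries? σ ρ ρ′ = allDart? λ d → rotDart ρ′ (mapDart (symmetry σ) d) ≟ᵈ mapDart (symmetry σ) (rotDart ρ d)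

carries⇒isomorphic : ∀ σ {ρ ρ′} → Carries σ ρ ρ′ → IsomorphicEmbeddings ρ ρ′
carries⇒isomorphic σ carries = symmetry σ , symmetry-isAutomorphism σ , carries

o₀ : Orientation
o₀ = (true ∷ true ∷ true ∷ []) , (true ∷ true ∷ false ∷ [])

ρ₀ : Rotation
ρ₀ = rotationOf o₀

genusTwo⇒carriedTo-ρ₀? : Dec (∀ o → EmbedsOnGenus (rotationOf o) 2 → Any (λ σ → Carries σ (rotationOf o) ρ₀) symmetries)
genusTwo⇒carriedTo-ρ₀? = allOrientation? λ o →
  (_ ≟ⁿ _) →-dec anyᴸ? (λ σ → carries? σ (rotationOf o) ρ₀) symmetries
  where
  allOrientation? : {P : Orientation → Set} → Decidable P → Dec (∀ o → P o)
  allOrientation? P? = map′ (λ all (os , os′) → all os os′) (λ all os os′ → all (os , os′))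
    (allBoolVec? λ os → allBoolVec? λ os′ → P? (os , os′))

-- The implicit arguments are explicit: solving them against EmbedsOnGenus would unfold
-- faces of a rotation system that is not known.
genusTwo⇒isomorphic-ρ₀ : ∀ ρ → IsRotationSystem ρ → EmbedsOnGenus ρ 2 → IsomorphicEmbeddings ρ ρ₀
genusTwo⇒isomorphic-ρ₀ ρ R genusTwo =
  isomorphicEmbeddings-congˡ {ρ} {ρₒ} {ρ₀} ρ≋ρₒ (carries⇒isomorphic (proj₁ carried) {ρₒ} {ρ₀} (proj₂ carried))
  where
  o : Orientation
  o = orientationOf ρ R
  ρₒ : Rotation
  ρₒ = rotationOf o
  ρ≋ρₒ : ρ ≋ ρₒ
  ρ≋ρₒ = rotationOf-orientationOf ρ R
  carried : ∃ λ σ → Carries σ ρₒ ρ₀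
  carried = satisfied (from-yes genusTwo⇒carriedTo-ρ₀? o (embedsOnGenus-cong {ρ} {ρₒ} {2} ρ≋ρₒ genusTwo))

theorem12 : ∃ λ ρ₀ → (IsRotationSystem ρ₀ × EmbedsOnGenus ρ₀ 2)
                × (∀ ρ → IsRotationSystem ρ → EmbedsOnGenus ρ 2 → IsomorphicEmbeddings ρ ρ₀)
theorem12 = ρ₀ , (rotationOf-isRotationSystem o₀ , refl) , genusTwo⇒isomorphic-ρ₀
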